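{- Let $\mathcal{G}$ and $\mathcal{H}$ be two hypergraphs on vertex set $V$ satisfying the intersection property, and let $\sigma=\langle\mathrm{In},\mathrm{Ex}\rangle$ be a covering assignment. Then: (a) $\mathrm{In}$ and $\mathrm{Ex}$ cannot both be covering; (b) $\mathcal{G}(\sigma)$ and $\mathcal{H}(\sigma)$ are trivially dual; in particular, if $\mathrm{In}$ is covering then $\mathcal{G}(\sigma)=\emptyset$ and $\mathcal{H}(\sigma)=\{\emptyset\}$, and if $\mathrm{Ex}$ is covering then $\mathcal{G}(\sigma)=\{\emptyset\}$ and $\mathcal{H}(\sigma)=\emptyset$.
   Context: Hypergraphs $\mathcal{G},\mathcal{H}$ are identified with their edge sets, non-empty and without the empty edge. Intersection property: $G\cap H\neq\emptyset$ for all $G\in\mathcal{G},H\in\mathcal{H}$. An assignment is a pair $\langle\mathrm{In},\mathrm{Ex}\rangle$ of disjoint subsets of $V$; $\mathrm{In}$ is covering if $H\subseteq\mathrm{In}$ for some $H\in\mathcal{H}$; $\mathrm{Ex}$ is covering if $G\subseteq\mathrm{Ex}$ for some $G\in\mathcal{G}$; $\sigma$ is covering if $\mathrm{In}$ or $\mathrm{Ex}$ is. For $S\subseteq V$: $\mathcal{G}_S=\{G\in\mathcal{G}:G\subseteq S\}$, $\mathcal{G}^S=\min(\{G\cap S:G\in\mathcal{G}\})$. $\mathcal{G}(\sigma)=(\mathcal{G}_{V\setminus\mathrm{In}})^{V\setminus(\mathrm{In}\cup\mathrm{Ex})}$, $\mathcal{H}(\sigma)=(\mathcal{H}_{V\setminus\mathrm{Ex}})^{V\setminus(\mathrm{In}\cup\mathrm{Ex})}$.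 Two hypergraphs are trivially dual if one is the empty hypergraph $\emptyset$ and the other is the empty-edge hypergraph $\{\emptyset\}$. -}

module Defs where

open import Data.Nat using (ℕ)
open import Data.Fin.Subset using (Subset; _⊆_; _∩_; _∪_; ∁; ⊥)
open import Data.Product using (Σ; ∃; _×_; _,_)
open import Data.Sum using (_⊎_)
open import Relation.Nullary using (¬_)
open import Relation.Binary.PropositionalEquality using (_≡_; _≢_)
open import Function.Bundles using (_⇔_)

-- A hypergraph on the vertex set V = Fin n, identified with its set of
-- edges, given as a membership predicate on subsets of V.
Hypergraph : ℕ → Set₁
Hypergraph n = Subset n → Set

IsHypergraph : ∀ {n} → Hypergraph n → Set
IsHypergraph 𝒢 = (∃ λ G → 𝒢 G) × ¬ 𝒢 ⊥

IntersectionProperty : ∀ {n} → Hypergraph n → Hypergraph n → Set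
IntersectionProperty 𝒢 ℋ = ∀ G H → 𝒢 G → ℋ H → G ∩ H ≢ ⊥

record Assignment (n : ℕ) : Set where
  field
    In       : Subset n
    Ex       : Subset n
    disjoint : In ∩ Ex ≡ ⊥
open Assignment public

InCovering : ∀ {n} → Hypergraph n → Assignment n → Set
InCovering ℋ σ = ∃ λ H → ℋ H × H ⊆ In σ

ExCovering : ∀ {n} → Hypergraph n → Assignment n → Set
ExCovering 𝒢 σ = ∃ λ G → 𝒢 G × G ⊆ Ex σ

Covering : ∀ {n} → Hypergraph n → Hypergraph n → Assignment n → Set
Covering 𝒢 ℋ σ = InCovering ℋ σ ⊎ ExCovering 𝒢 σ

restrict : ∀ {n} → Hypergraph n → Subset n → Hypergraph n
restrict 𝒢 S X = 𝒢 X × X ⊆ S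

min : ∀ {n} → Hypergraph n → Hypergraph n
min F X = F X × (∀ Y → F Y → Y ⊆ X → Y ≡ X)

trace : ∀ {n} → Hypergraph n → Subset n → Hypergraph n
trace 𝒢 S = min (λ X → ∃ λ G → 𝒢 G × X ≡ G ∩ S)

free : ∀ {n} → Assignment n → Subset n
free σ = ∁ (In σ ∪ Ex σ)

𝒢⟨_⟩ : ∀ {n} → Assignment n → Hypergraph n → Hypergraph n
𝒢⟨ σ ⟩ 𝒢 = trace (restrict 𝒢 (∁ (In σ))) (free σ)

ℋ⟨_⟩ : ∀ {n} → Assignment n → Hypergraph n → Hypergraph n
ℋ⟨ σ ⟩ ℋ = trace (restrict ℋ (∁ (Ex σ))) (free σ)

IsEmptyHypergraph : ∀ {n} → Hypergraph n → Set
IsEmptyHypergraph 𝒢 = ∀ X → ¬ 𝒢 X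

IsEmptyEdgeHypergraph : ∀ {n} → Hypergraph n → Set
IsEmptyEdgeHypergraph 𝒢 = ∀ X → 𝒢 X ⇔ (X ≡ ⊥)

TriviallyDual : ∀ {n} → Hypergraph n → Hypergraph n → Set
TriviallyDual 𝒜 ℬ =
  (IsEmptyHypergraph 𝒜 × IsEmptyEdgeHypergraph ℬ) ⊎
  (IsEmptyEdgeHypergraph 𝒜 × IsEmptyHypergraph ℬ)

-- The assigned parts In and Ex are disjoint, so an edge of ℋ inside In and an
-- edge of 𝒢 inside Ex would violate the intersection property; this gives (a).
-- If In covers via H ∈ ℋ, every G ∈ 𝒢 meets H ⊆ In, so no edge of 𝒢 avoids In
-- and 𝒢(σ) is empty, while H avoids Ex and misses the free vertices, so the
-- traces defining ℋ(σ) contain ∅ and their minimal members are exactly {∅}.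
-- The case where Ex covers is symmetric, and (b) is the union of both cases.
module Submission where

open import Defs
open import Data.Nat using (ℕ)
open import Data.Product using (_×_; _,_; uncurry)
open import Data.Sum using (inj₁; inj₂)
open import Relation.Nullary using (¬_)
open import Data.Fin.Subset using (Subset; _∈_; _∉_; _⊆_; _∩_; _∪_; ∁; ⊥)
open import Data.Fin.Subset.Properties
  using (Empty-unique; ∉⊥; ⊥⊆; ⊆-antisym; x∈p∩q⁺; x∈p∩q⁻; x∈p∪q⁺; x∉p⇒x∈∁p; x∈p⇒x∉∁p; x∈∁p⇒x∉p)
open import Relation.Binary.PropositionalEquality using (_≡_; refl; sym; subst)
open import Function.Bundles using (mk⇔)

private variable
  n : ℕ
  A B K : Subset n

∩≡⊥ : (∀ {x} → x ∈ A → x ∉ B) → A ∩ B ≡ ⊥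
∩≡⊥ {A = A} {B} A∌B = Empty-unique λ (_ , x∈A∩B) → uncurry A∌B (x∈p∩q⁻ A B x∈A∩B)

∩≡⊥⇒∉ : A ∩ B ≡ ⊥ → ∀ {x} → x ∈ A → x ∉ B
∩≡⊥⇒∉ A∩B≡⊥ x∈A x∈B = ∉⊥ (subst (_ ∈_) A∩B≡⊥ (x∈p∩q⁺ (x∈A , x∈B)))

⊆ˡ⇒⊆∁ʳ : A ∩ B ≡ ⊥ → K ⊆ A → K ⊆ ∁ B
⊆ˡ⇒⊆∁ʳ A∩B≡⊥ K⊆A x∈K = x∉p⇒x∈∁p (∩≡⊥⇒∉ A∩B≡⊥ (K⊆A x∈K))

⊆ʳ⇒⊆∁ˡ : A ∩ B ≡ ⊥ → K ⊆ B → K ⊆ ∁ A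
⊆ʳ⇒⊆∁ˡ A∩B≡⊥ K⊆B x∈K = x∉p⇒x∈∁p λ x∈A → ∩≡⊥⇒∉ A∩B≡⊥ x∈A (K⊆B x∈K)

⊆⊥⇒≡⊥ : A ⊆ ⊥ → A ≡ ⊥
⊆⊥⇒≡⊥ A⊆⊥ = ⊆-antisym A⊆⊥ ⊥⊆

⊆ˡ⇒∩∁∪≡⊥ : K ⊆ A → K ∩ ∁ (A ∪ B) ≡ ⊥
⊆ˡ⇒∩∁∪≡⊥ K⊆A = ∩≡⊥ λ x∈K → x∈p⇒x∉∁p (x∈p∪q⁺ (inj₁ (K⊆A x∈K)))

⊆ʳ⇒∩∁∪≡⊥ : K ⊆ B → K ∩ ∁ (A ∪ B) ≡ ⊥
⊆ʳ⇒∩∁∪≡⊥ K⊆B = ∩≡⊥ λ x∈K → x∈p⇒x∉∁p (x∈p∪q⁺ (inj₂ (K⊆B x∈K)))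

edges-not-disjoint : {𝒢 ℋ : Hypergraph n} {G H : Subset n} →
  IntersectionProperty 𝒢 ℋ → 𝒢 G → ℋ H → ¬ (∀ {x} → x ∈ G → x ∉ H)
edges-not-disjoint ip gG hH G∌H = ip _ _ gG hH (∩≡⊥ G∌H)

trace-empty : {𝒦 : Hypergraph n} (F : Subset n) →
  IsEmptyHypergraph 𝒦 → IsEmptyHypergraph (trace 𝒦 F)
trace-empty F 𝒦-empty X ((K , kK , _) , _) = 𝒦-empty K kK

-- An edge missing F makes ∅ one of the traces, and ∅ lies below every trace.
trace-emptyEdge : {𝒦 : Hypergraph n} {F : Subset n} →
  𝒦 K → K ∩ F ≡ ⊥ → IsEmptyEdgeHypergraph (trace 𝒦 F)
trace-emptyEdge {K = K} {𝒦} {F} kK K∩F≡⊥ X = mk⇔ minimal⇒≡⊥ ≡⊥⇒minimal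
  where
  minimal⇒≡⊥ : trace 𝒦 F X → X ≡ ⊥
  minimal⇒≡⊥ (_ , minimal) = sym (minimal ⊥ (K , kK , sym K∩F≡⊥) ⊥⊆)
  ≡⊥⇒minimal : X ≡ ⊥ → trace 𝒦 F X
  ≡⊥⇒minimal refl = (K , kK , sym K∩F≡⊥) , λ _ _ → ⊆⊥⇒≡⊥

module _ (𝒢 ℋ : Hypergraph n) (σ : Assignment n) where

  InCovering⇒𝒢⟨⟩-empty : IntersectionProperty 𝒢 ℋ →
    InCovering ℋ σ → IsEmptyHypergraph (𝒢⟨ σ ⟩ 𝒢)
  InCovering⇒𝒢⟨⟩-empty ip (H , hH , H⊆In) = trace-empty (free σ) λ G (gG , G⊆∁In) →
    edges-not-disjoint ip gG hH λ x∈G x∈H → x∈∁p⇒x∉p (G⊆∁In x∈G) (H⊆In x∈H)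

  InCovering⇒ℋ⟨⟩-emptyEdge : InCovering ℋ σ → IsEmptyEdgeHypergraph (ℋ⟨ σ ⟩ ℋ)
  InCovering⇒ℋ⟨⟩-emptyEdge (H , hH , H⊆In) =
    trace-emptyEdge {𝒦 = restrict ℋ (∁ (Ex σ))}
      (hH , ⊆ˡ⇒⊆∁ʳ (disjoint σ) H⊆In) (⊆ˡ⇒∩∁∪≡⊥ H⊆In)

  ExCovering⇒𝒢⟨⟩-emptyEdge : ExCovering 𝒢 σ → IsEmptyEdgeHypergraph (𝒢⟨ σ ⟩ 𝒢)
  ExCovering⇒𝒢⟨⟩-emptyEdge (G , gG , G⊆Ex) =
    trace-emptyEdge {𝒦 = restrict 𝒢 (∁ (In σ))}
      (gG , ⊆ʳ⇒⊆∁ˡ (disjoint σ) G⊆Ex) (⊆ʳ⇒∩∁∪≡⊥ G⊆Ex)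

  ExCovering⇒ℋ⟨⟩-empty : IntersectionProperty 𝒢 ℋ →
    ExCovering 𝒢 σ → IsEmptyHypergraph (ℋ⟨ σ ⟩ ℋ)
  ExCovering⇒ℋ⟨⟩-empty ip (G , gG , G⊆Ex) = trace-empty (free σ) λ H (hH , H⊆∁Ex) →
    edges-not-disjoint ip gG hH λ x∈G x∈H → x∈∁p⇒x∉p (H⊆∁Ex x∈H) (G⊆Ex x∈G)

  ¬InCovering×ExCovering : IntersectionProperty 𝒢 ℋ →
    ¬ (InCovering ℋ σ × ExCovering 𝒢 σ)
  ¬InCovering×ExCovering ip ((H , hH , H⊆In) , (G , gG , G⊆Ex)) =
    edges-not-disjoint ip gG hH λ x∈G x∈H → ∩≡⊥⇒∉ (disjoint σ) (H⊆In x∈H) (G⊆Ex x∈G)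

lemma19 : (n : ℕ) (𝒢 ℋ : Hypergraph n) →
    IsHypergraph 𝒢 → IsHypergraph ℋ → IntersectionProperty 𝒢 ℋ →
    (σ : Assignment n) → Covering 𝒢 ℋ σ →
    ¬ (InCovering ℋ σ × ExCovering 𝒢 σ)
    × TriviallyDual (𝒢⟨ σ ⟩ 𝒢) (ℋ⟨ σ ⟩ ℋ)
    × (InCovering ℋ σ →
        IsEmptyHypergraph (𝒢⟨ σ ⟩ 𝒢) × IsEmptyEdgeHypergraph (ℋ⟨ σ ⟩ ℋ))
    × (ExCovering 𝒢 σ →
        IsEmptyEdgeHypergraph (𝒢⟨ σ ⟩ 𝒢) × IsEmptyHypergraph (ℋ⟨ σ ⟩ ℋ))
lemma19 n 𝒢 ℋ _ _ ip σ covering =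
  ¬InCovering×ExCovering 𝒢 ℋ σ ip , triviallyDual covering , inCase , exCase
  where
  inCase : InCovering ℋ σ →
    IsEmptyHypergraph (𝒢⟨ σ ⟩ 𝒢) × IsEmptyEdgeHypergraph (ℋ⟨ σ ⟩ ℋ)
  inCase c = InCovering⇒𝒢⟨⟩-empty 𝒢 ℋ σ ip c , InCovering⇒ℋ⟨⟩-emptyEdge 𝒢 ℋ σ c

  exCase : ExCovering 𝒢 σ →
    IsEmptyEdgeHypergraph (𝒢⟨ σ ⟩ 𝒢) × IsEmptyHypergraph (ℋ⟨ σ ⟩ ℋ)
  exCase c = ExCovering⇒𝒢⟨⟩-emptyEdge 𝒢 ℋ σ c , ExCovering⇒ℋ⟨⟩-empty 𝒢 ℋ σ ip c

  triviallyDual : Covering 𝒢 ℋ σ → TriviallyDual (𝒢⟨ σ ⟩ 𝒢) (ℋ⟨ σ ⟩ ℋ)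
  triviallyDual (inj₁ c) = inj₁ (inCase c)
  triviallyDual (inj₂ c) = inj₂ (exCase c)
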